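{- Consider a 0-1 knapsack instance with capacity $c$ and $n$ items with weights $w_1 \ge w_2 \ge \cdots \ge w_n$ (all parameters strictly positive integers, $\sum_{i=1}^n w_i > c$, and $w_i \le c$ for all $i$). For $\mathbf{s}=(s_1,\ldots,s_n)\in\{0,1\}^n$ let $\text{totalWeight}(\mathbf{s})=\sum_{j=1}^n w_j s_j$. Let $X$ be the set of inclusionwise maximal solutions and, for $1\le i\le n$, let $$\text{Exclude}_i=\{\mathbf{x}\in X : x_i=0 \text{ and } x_j=1 \text{ for all integers } j \text{ with } i+1\le j\le n\}.$$ Then for every $\mathbf{s}\in\{0,1\}^n$ and every $i$ with $1\le i\le n$, the following three conditions are equivalent: (1) $\mathbf{s}\in\text{Exclude}_i$; (2) $c+1-w_i \le \text{totalWeight}(\mathbf{s}) \le c$, $s_i=0$, and $s_j=1$ for all $j$ with $i+1\le j\le n$; (3) $c+1-\sum_{j=i}^{n} w_j \le \sum_{j=1}^{i-1} s_j w_j \le c-\sum_{j=i+1}^{n} w_j$, $s_i=0$, and $s_j=1$ for all $j$ with $i+1\le j\le n$.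
   Context: A 0-1 knapsack instance has capacity $c$, weights $w_1,\ldots,w_n$ and profits $p_1,\ldots,p_n$; a solution is a vector $\mathbf{x}\in\{0,1\}^n$. A solution $\mathbf{x}$ is inclusionwise maximal (an IMS) if it is feasible, i.e. $\sum_{i=1}^n w_i x_i \le c$, and there is no index $j$ with $x_j=0$ and $w_j+\sum_{i=1}^n w_i x_i \le c$. -}

module Defs where

open import Data.Nat using (ℕ; zero; suc; _+_; _*_; _≤_; _<_; _>_; _≤?_; _<?_)
open import Data.Nat.Properties using ()
open import Data.Fin using (Fin; toℕ)
open import Data.Bool using (Bool; true; false; if_then_else_)
open import Data.Product using (_×_; Σ; ∃)
open import Relation.Nullary using (¬_; Dec)
open import Relation.Nullary.Decidable using (⌊_⌋)
open import Data.Vec.Functional using (Vector; foldr)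
open import Relation.Binary.PropositionalEquality using (_≡_)

-- Items are indexed by Fin n; item k : Fin n is the paper's item number toℕ k + 1.
-- A solution is a 0-1 vector, represented as Fin n → Bool (true = 1).

bit : Bool → ℕ
bit true  = 1
bit false = 0

sumFin : ∀ {n} → (Fin n → ℕ) → ℕ
sumFin {n} f = foldr _+_ 0 f

sumWhere : ∀ {n} → (Fin n → Bool) → (Fin n → ℕ) → ℕ
sumWhere P f = sumFin (λ k → if P k then f k else 0)

totalWeight : ∀ {n} → (Fin n → ℕ) → (Fin n → Bool) → ℕ
totalWeight w s = sumFin (λ j → w j * bit (s j))

feasible : ∀ {n} → ℕ → (Fin n → ℕ) → (Fin n → Bool) → Set
feasible c w x = totalWeight w x ≤ c

IMS : ∀ {n} → ℕ → (Fin n → ℕ) → (Fin n → Bool) → Set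
IMS c w x = feasible c w x ×
  (¬ Σ (Fin _) (λ j → (x j ≡ false) × (w j + totalWeight w x ≤ c)))

TailOnes : ∀ {n} → Fin n → (Fin n → Bool) → Set
TailOnes i s = ∀ j → toℕ i < toℕ j → s j ≡ true

Exclude : ∀ {n} → ℕ → (Fin n → ℕ) → Fin n → (Fin n → Bool) → Set
Exclude c w i x = IMS c w x × (x i ≡ false) × TailOnes i x

{-# OPTIONS --safe #-}
-- Once s_i = 0 and every later item is packed, the items s leaves out all come no later than i,
-- so (weights being non-increasing) item i is the lightest of them: s is maximal exactly when
-- item i does not fit.  Splitting totalWeight at i turns condition (2) into condition (3).
module Submission where

open import Defs
open import Data.Nat using (ℕ; _*_; _≤_; _<_; _≥_; _>_; _≤ᵇ_; _<ᵇ_)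
open import Data.Fin using (Fin; toℕ)
open import Data.Bool using (Bool; true; false)
open import Data.Product using (_×_)
open import Function.Bundles using (_⇔_)
open import Data.Integer using (ℤ; +_; _-_) renaming (_≤_ to _≤ℤ_; _+_ to _+ℤ_)
open import Relation.Binary.PropositionalEquality using (_≡_)

open import Data.Nat using (zero; suc; _+_; _≡ᵇ_)
open import Data.Nat.Properties
  using (+-identityʳ; +-comm; *-zeroʳ; *-identityʳ; +-commutativeSemigroup; +-monoʳ-≤;
         ≤-trans; ≰⇒>; ≮⇒≥; <ᵇ⇒<; m+1+n≰m; _<?_)
open import Data.Integer using (-_; +≤+)
import Data.Integer.Properties as ℤ
open import Algebra.Properties.AbelianGroup ℤ.+-0-abelianGroup using (//-rightDividesˡ; //-rightDividesʳ)
open import Algebra.Properties.CommutativeSemigroup +-commutativeSemigroup using (interchange; xy∙z≈x∙zy)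
open import Data.Fin using (zero; suc)
open import Data.Bool using (if_then_else_)
open import Data.Bool.Properties using (T-≡)
open import Data.Product using (_,_; Σ)
open import Data.Product.Function.NonDependent.Propositional using (_×-⇔_)
open import Relation.Nullary using (¬_; yes; no; contradiction)
open import Relation.Binary.PropositionalEquality
  using (refl; sym; trans; cong; cong₂; subst; subst₂; module ≡-Reasoning)
open import Function.Bundles using (mk⇔; Equivalence)
import Function.Properties.Equivalence as ⇔

open ≡-Reasoning

sumFin-cong : ∀ {n} {f g : Fin n → ℕ} → (∀ k → f k ≡ g k) → sumFin f ≡ sumFin g
sumFin-cong {zero}  f≡g = refl
sumFin-cong {suc n} f≡g = cong₂ _+_ (f≡g zero) (sumFin-cong (λ k → f≡g (suc k)))

sumFin-+ : ∀ {n} (f g : Fin n → ℕ) → sumFin (λ k → f k + g k) ≡ sumFin f + sumFin g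
sumFin-+ {zero}  f g = refl
sumFin-+ {suc n} f g = begin
  (f zero + g zero) + sumFin (λ k → f (suc k) + g (suc k))
    ≡⟨ cong (λ x → (f zero + g zero) + x) (sumFin-+ (λ k → f (suc k)) (λ k → g (suc k))) ⟩
  (f zero + g zero) + (sumFin (λ k → f (suc k)) + sumFin (λ k → g (suc k)))
    ≡⟨ interchange (f zero) (g zero) _ _ ⟩
  sumFin f + sumFin g ∎

sumFin-0 : ∀ {n} → sumFin {n} (λ _ → 0) ≡ 0
sumFin-0 {zero}  = refl
sumFin-0 {suc n} = sumFin-0 {n}

sumWhere-≡ᵇ : ∀ {n} (f : Fin n → ℕ) (i : Fin n) → sumWhere (λ j → toℕ j ≡ᵇ toℕ i) f ≡ f i
sumWhere-≡ᵇ {suc n} f zero    = trans (cong (λ x → f zero + x) (sumFin-0 {n})) (+-identityʳ (f zero))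
sumWhere-≡ᵇ {suc n} f (suc i) = sumWhere-≡ᵇ (λ k → f (suc k)) i

sumWhere-cong : ∀ {n} (P : Fin n → Bool) {f g : Fin n → ℕ} →
                (∀ j → P j ≡ true → f j ≡ g j) → sumWhere P f ≡ sumWhere P g
sumWhere-cong P {f} {g} f≡g = sumFin-cong pointwise
  where
  pointwise : ∀ k → (if P k then f k else 0) ≡ (if P k then g k else 0)
  pointwise k with P k in Pk
  ... | true  = f≡g k Pk
  ... | false = refl

sumBefore sumAfter sumFrom : ∀ {n} → Fin n → (Fin n → ℕ) → ℕ
sumBefore i = sumWhere (λ j → toℕ j <ᵇ toℕ i)
sumAfter  i = sumWhere (λ j → toℕ i <ᵇ toℕ j)
sumFrom   i = sumWhere (λ j → toℕ i ≤ᵇ toℕ j)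

if-<ᵇ-≡ᵇ-<ᵇ : ∀ m n x → x ≡ (if m <ᵇ n then x else 0) + ((if m ≡ᵇ n then x else 0) + (if n <ᵇ m then x else 0))
if-<ᵇ-≡ᵇ-<ᵇ zero    zero    x = sym (+-identityʳ x)
if-<ᵇ-≡ᵇ-<ᵇ zero    (suc n) x = sym (+-identityʳ x)
if-<ᵇ-≡ᵇ-<ᵇ (suc m) zero    x = refl
if-<ᵇ-≡ᵇ-<ᵇ (suc m) (suc n) x = if-<ᵇ-≡ᵇ-<ᵇ m n x

-- suc n ≤ᵇ suc m unfolds to n <ᵇ suc m, which computes only once n is split as well.
if-≤ᵇ-split : ∀ m n x → (if n ≤ᵇ m then x else 0) ≡ (if m ≡ᵇ n then x else 0) + (if n <ᵇ m then x else 0)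
if-≤ᵇ-split zero    zero          x = sym (+-identityʳ x)
if-≤ᵇ-split (suc m) zero          x = refl
if-≤ᵇ-split zero    (suc n)       x = refl
if-≤ᵇ-split (suc m) (suc zero)    x = if-≤ᵇ-split m zero x
if-≤ᵇ-split (suc m) (suc (suc n)) x = if-≤ᵇ-split m (suc n) x

sumFin-splitAt : ∀ {n} (i : Fin n) (f : Fin n → ℕ) → sumFin f ≡ sumBefore i f + (f i + sumAfter i f)
sumFin-splitAt {n} i f = begin
  sumFin f
    ≡⟨ sumFin-cong (λ j → if-<ᵇ-≡ᵇ-<ᵇ (toℕ j) (toℕ i) (f j)) ⟩
  sumFin (λ j → before j + (at j + after j))
    ≡⟨ sumFin-+ before (λ j → at j + after j) ⟩
  sumBefore i f + sumFin (λ j → at j + after j)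
    ≡⟨ cong (λ x → sumBefore i f + x) (sumFin-+ at after) ⟩
  sumBefore i f + (sumFin at + sumAfter i f)
    ≡⟨ cong (λ x → sumBefore i f + (x + sumAfter i f)) (sumWhere-≡ᵇ f i) ⟩
  sumBefore i f + (f i + sumAfter i f) ∎
  where
  before at after : Fin n → ℕ
  before j = if toℕ j <ᵇ toℕ i then f j else 0
  at     j = if toℕ j ≡ᵇ toℕ i then f j else 0
  after  j = if toℕ i <ᵇ toℕ j then f j else 0

sumFrom-split : ∀ {n} (i : Fin n) (f : Fin n → ℕ) → sumFrom i f ≡ f i + sumAfter i f
sumFrom-split {n} i f = begin
  sumFrom i f
    ≡⟨ sumFin-cong (λ j → if-≤ᵇ-split (toℕ j) (toℕ i) (f j)) ⟩
  sumFin (λ j → at j + after j)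
    ≡⟨ sumFin-+ at after ⟩
  sumFin at + sumAfter i f
    ≡⟨ cong (_+ sumAfter i f) (sumWhere-≡ᵇ f i) ⟩
  f i + sumAfter i f ∎
  where
  at after : Fin n → ℕ
  at    j = if toℕ j ≡ᵇ toℕ i then f j else 0
  after j = if toℕ i <ᵇ toℕ j then f j else 0

+m-+n≤+o⇔m≤o+n : ∀ m n o → (+ m - + n ≤ℤ + o) ⇔ (m ≤ o + n)
+m-+n≤+o⇔m≤o+n m n o = mk⇔
  (λ le → ℤ.drop‿+≤+ (subst (_≤ℤ + (o + n)) (//-rightDividesˡ (+ n) (+ m)) (ℤ.+-monoˡ-≤ (+ n) le)))
  (λ le → subst (+ m - + n ≤ℤ_) (//-rightDividesʳ (+ n) (+ o)) (ℤ.+-monoˡ-≤ (- + n) (+≤+ le)))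

+o≤+m-+n⇔o+n≤m : ∀ m n o → (+ o ≤ℤ + m - + n) ⇔ (o + n ≤ m)
+o≤+m-+n⇔o+n≤m m n o = mk⇔
  (λ le → ℤ.drop‿+≤+ (subst (+ (o + n) ≤ℤ_) (//-rightDividesˡ (+ n) (+ m)) (ℤ.+-monoˡ-≤ (+ n) le)))
  (λ le → subst (_≤ℤ + m - + n) (//-rightDividesʳ (+ n) (+ o)) (ℤ.+-monoˡ-≤ (- + n) (+≤+ le)))

Antitone : ∀ {n} → (Fin n → ℕ) → Set
Antitone w = ∀ i j → toℕ i ≤ toℕ j → w j ≤ w i

packedWeight : ∀ {n} → (Fin n → ℕ) → (Fin n → Bool) → Fin n → ℕ
packedWeight w s j = w j * bit (s j)

module _ {n} (c : ℕ) (w : Fin n → ℕ) (i : Fin n) (s : Fin n → Bool) where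

  ExcludeByWeight : Set
  ExcludeByWeight = (c + 1 ≤ totalWeight w s + w i) × totalWeight w s ≤ c × s i ≡ false × TailOnes i s

  exclude⇔byWeight : Antitone w → Exclude c w i s ⇔ ExcludeByWeight
  exclude⇔byWeight antitone = mk⇔ to from
    where
    to : Exclude c w i s → ExcludeByWeight
    to ((feasible , maximal) , sᵢ≡0 , tail) = overflow , feasible , sᵢ≡0 , tail
      where
      overflow : c + 1 ≤ totalWeight w s + w i
      overflow = subst₂ _≤_ (+-comm 1 c) (+-comm (w i) (totalWeight w s))
                   (≰⇒> (λ fits → maximal (i , sᵢ≡0 , fits)))
    from : ExcludeByWeight → Exclude c w i s
    from (overflow , feasible , sᵢ≡0 , tail) = (feasible , maximal) , sᵢ≡0 , tail
      where
      maximal : ¬ Σ (Fin n) (λ j → s j ≡ false × w j + totalWeight w s ≤ c)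
      maximal (j , sⱼ≡0 , fits) with toℕ i <? toℕ j
      ... | yes i<j = contradiction (trans (sym sⱼ≡0) (tail j i<j)) λ ()
      ... | no  i≮j = m+1+n≰m c (≤-trans overflow (≤-trans
                        (+-monoʳ-≤ (totalWeight w s) (antitone j i (≮⇒≥ i≮j)))
                        (subst (_≤ c) (+-comm (w j) (totalWeight w s)) fits)))

  totalWeight-split : s i ≡ false → TailOnes i s →
    totalWeight w s ≡ sumBefore i (packedWeight w s) + sumAfter i w
  totalWeight-split sᵢ≡0 tail = begin
    totalWeight w s
      ≡⟨ sumFin-splitAt i (packedWeight w s) ⟩
    sumBefore i (packedWeight w s) + (packedWeight w s i + sumAfter i (packedWeight w s))
      ≡⟨ cong (λ x → sumBefore i (packedWeight w s) + x) (cong₂ _+_ item-i-unpacked tail-packed) ⟩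
    sumBefore i (packedWeight w s) + sumAfter i w ∎
    where
    item-i-unpacked : packedWeight w s i ≡ 0
    item-i-unpacked = trans (cong (λ b → w i * bit b) sᵢ≡0) (*-zeroʳ (w i))
    tail-packed : sumAfter i (packedWeight w s) ≡ sumAfter i w
    tail-packed = sumWhere-cong _ λ j i<ᵇj →
      trans (cong (λ b → w j * bit b) (tail j (<ᵇ⇒< (toℕ i) (toℕ j) (Equivalence.from T-≡ i<ᵇj))))
            (*-identityʳ (w j))

  overflow-split : s i ≡ false → TailOnes i s →
    totalWeight w s + w i ≡ sumBefore i (packedWeight w s) + sumFrom i w
  overflow-split sᵢ≡0 tail = begin
    totalWeight w s + w i
      ≡⟨ cong (_+ w i) (totalWeight-split sᵢ≡0 tail) ⟩
    (sumBefore i (packedWeight w s) + sumAfter i w) + w i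
      ≡⟨ xy∙z≈x∙zy (sumBefore i (packedWeight w s)) (sumAfter i w) (w i) ⟩
    sumBefore i (packedWeight w s) + (w i + sumAfter i w)
      ≡⟨ cong (λ x → sumBefore i (packedWeight w s) + x) (sym (sumFrom-split i w)) ⟩
    sumBefore i (packedWeight w s) + sumFrom i w ∎

  ExcludeByPrefix : Set
  ExcludeByPrefix = (c + 1 ≤ sumBefore i (packedWeight w s) + sumFrom i w)
                  × sumBefore i (packedWeight w s) + sumAfter i w ≤ c
                  × s i ≡ false × TailOnes i s

  byWeight⇔byPrefix : ExcludeByWeight ⇔ ExcludeByPrefix
  byWeight⇔byPrefix = mk⇔
    (λ (overflow , feasible , sᵢ≡0 , tail) →
       subst (c + 1 ≤_) (overflow-split sᵢ≡0 tail) overflow ,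
       subst (_≤ c) (totalWeight-split sᵢ≡0 tail) feasible , sᵢ≡0 , tail)
    (λ (overflow , feasible , sᵢ≡0 , tail) →
       subst (c + 1 ≤_) (sym (overflow-split sᵢ≡0 tail)) overflow ,
       subst (_≤ c) (sym (totalWeight-split sᵢ≡0 tail)) feasible , sᵢ≡0 , tail)

lemma1 : (n c : ℕ) (w : Fin n → ℕ) →
         c > 0 → (∀ i → w i > 0) →
         (∀ i j → toℕ i ≤ toℕ j → w j ≤ w i) →
         totalWeight w (λ _ → true) > c →
         (∀ i → w i ≤ c) →
         (s : Fin n → Bool) (i : Fin n) →
         (Exclude c w i s ⇔ ((((+ c) +ℤ (+ 1)) - (+ w i) ≤ℤ (+ totalWeight w s)) × (totalWeight w s ≤ c) × (s i ≡ false) × TailOnes i s))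
         × (Exclude c w i s ⇔ ((((+ c) +ℤ (+ 1)) - (+ sumWhere (λ j → toℕ i ≤ᵇ toℕ j) w) ≤ℤ (+ sumWhere (λ j → toℕ j <ᵇ toℕ i) (λ j → w j * bit (s j))))
                               × ((+ sumWhere (λ j → toℕ j <ᵇ toℕ i) (λ j → w j * bit (s j))) ≤ℤ ((+ c) - (+ sumWhere (λ j → toℕ i <ᵇ toℕ j) w)))
                               × (s i ≡ false) × TailOnes i s))
lemma1 n c w _ _ antitone _ _ s i =
    ⇔.trans byWeight (⇔.sym (+m-+n≤+o⇔m≤o+n (c + 1) (w i) (totalWeight w s)) ×-⇔ ⇔.refl)
  , ⇔.trans byWeight (⇔.trans (byWeight⇔byPrefix c w i s)
      (⇔.sym (+m-+n≤+o⇔m≤o+n (c + 1) (sumFrom i w) prefix)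
       ×-⇔ ⇔.sym (+o≤+m-+n⇔o+n≤m c (sumAfter i w) prefix)
       ×-⇔ ⇔.refl))
  where
  byWeight : Exclude c w i s ⇔ ExcludeByWeight c w i s
  byWeight = exclude⇔byWeight c w i s antitone
  prefix : ℕ
  prefix = sumBefore i (packedWeight w s)
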